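{- Let $a,b$ be positive integers such that $a/b$ is not the square of a rational number. Then there are infinitely many positive integers $c$ such that no binary (rank $2$) $\mathbb{Z}$-lattice represents all three integers $a$, $b$, $c$.
   Context: A $\mathbb{Z}$-lattice means a free $\mathbb{Z}$-module of finite rank with a positive definite integer-valued symmetric bilinear form $B$, $Q(x)=B(x,x)$. A $\mathbb{Z}$-lattice $L$ represents a positive integer $a$ if $Q(x)=a$ for some $x\in L$. -}

module Defs where

open import Data.Nat using (ℕ; suc)
open import Data.Integer using (ℤ; +_; _+_; _*_; _<_; 0ℤ)
open import Data.Product using (Σ; _×_; ∃)
open import Relation.Nullary using (¬_)
open import Relation.Binary.PropositionalEquality using (_≡_)

-- A binary (rank 2) Z-lattice, presented by its Gram matrix with respect to a
-- Z-basis e₁, e₂ of the free module Z²:  B(e₁,e₁) = g₁₁, B(e₁,e₂) = B(e₂,e₁) = g₁₂,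
-- B(e₂,e₂) = g₂₂ (symmetry is built in by using a single off-diagonal entry).

bilin : ℤ → ℤ → ℤ → (ℤ × ℤ) → (ℤ × ℤ) → ℤ
bilin g₁₁ g₁₂ g₂₂ (x₁ Data.Product., x₂) (y₁ Data.Product., y₂) =
  g₁₁ * x₁ * y₁ + g₁₂ * x₁ * y₂ + g₁₂ * x₂ * y₁ + g₂₂ * x₂ * y₂

record BinaryLattice : Set where
  field
    g₁₁ g₁₂ g₂₂ : ℤ
  B : (ℤ × ℤ) → (ℤ × ℤ) → ℤ
  B = bilin g₁₁ g₁₂ g₂₂
  Q : (ℤ × ℤ) → ℤ
  Q v = B v v
  field
    posDef : ∀ (v : ℤ × ℤ) → ¬ (v ≡ (0ℤ Data.Product., 0ℤ)) → 0ℤ < Q v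

Represents : BinaryLattice → ℕ → Set
Represents L a = ∃ λ (v : ℤ × ℤ) → BinaryLattice.Q L v ≡ + a

-- a/b is the square of a rational number (a, b positive):
-- a/b = (m/n)² with n ≠ 0, i.e. a n² = b m²
IsRatSquareQuot : ℕ → ℕ → Set
IsRatSquareQuot a b = ∃ λ (m : ℤ) → ∃ λ (n : ℕ) →
  (+ a) * (+ suc n) * (+ suc n) ≡ (+ b) * m * m

-- Suppose L represents a = Q v, b = Q w and c = Q x. Since a/b is not a rational square, v and w
-- are independent, k = det v w ≠ 0, and writing k x in the basis v, w and completing the square
-- gives a k² c = X² + D Z² with 1 ≤ D = Q v Q w − B(v,w)² ≤ ab. Pick u ≡ 7 (mod 8) that is a
-- quadratic nonresidue modulo every odd prime up to ab (built prime by prime, Chinese-remainder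
-- style) and take c = a u M² for large M; then u W² = X² + D Z² with W = a k M ≠ 0.
-- This equation has only solutions with W = 0: after stripping square factors from D, either an odd
-- prime p divides D exactly once, and as u is a nonresidue modulo p all of W, X, Z are divisible by
-- p, or D ∈ {1, 2}, and 7 W² ≡ X² + D Z² (mod 8) forces W, X, Z to be even. Infinite descent
-- finishes the argument.

module Submission where

open import Defs
open import Data.Nat as ℕ using (ℕ; zero; suc; _<_; _≤_; z≤n; s≤s; z<s; _∸_; _!; ⌈_/2⌉; NonZero)
import Data.Nat.Properties as ℕₚ
open import Data.Nat.Properties using (_<?_)
import Data.Nat.Divisibility as ℕᵈ
open import Data.Nat.Primality
  using (Prime; prime?; euclidsLemma; prime⇒irreducible; prime⇒nonZero; prime⇒nonTrivial)
open import Data.Nat.Primality.Factorisation using (factorise)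
open import Data.Nat.Coprimality using (Coprime; coprime-Bézout)
open import Data.Nat.GCD using (module Bézout)
open import Data.Nat.Induction using (<-wellFounded)
open import Induction.WellFounded using (Acc; acc)
open import Data.Integer as ℤ using (ℤ; +_; +0; +[1+_]; 0ℤ; 1ℤ; _+_; _*_; _-_; -_)
import Data.Integer.Properties as ℤₚ
open import Data.Integer.Divisibility.Signed
  using (_∣_; _∣?_; divides; ∣-refl; ∣-trans; ∣ᵤ⇒∣; ∣⇒∣ᵤ; ∣m∣n⇒∣m+n; ∣m⇒∣-m; ∣n⇒∣m*n)
open import Data.Integer.DivMod using (a≡a%ℕn+[a/ℕn]*n; n%ℕd<d)
open import Data.Integer.Tactic.RingSolver using (solve-∀; solve)
open import Data.Integer.Solver using (module +-*-Solver)
open +-*-Solver using (Polynomial; con; _:+_; _:*_; _:-_; :-_; _:=_) renaming (solve to solveᴾ)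
open import Data.Fin using (Fin; toℕ; fromℕ<)
open import Data.Fin.Properties using (any?; all?; ¬∀⟶∃¬; injective⇒≤; toℕ-injective; toℕ<n; toℕ-fromℕ<)
open import Data.List using (_∷_; [])
import Data.List.Relation.Unary.All as All
open import Data.Product using (_×_; _,_; ∃; proj₁; proj₂)
import Data.Product as Product
open import Data.Sum using (_⊎_; inj₁; inj₂)
import Data.Sum as Sum
open import Function using (_∘_)
open import Function.Definitions using (Injective)
open import Relation.Binary.Bundles using (Setoid)
open import Relation.Binary.PropositionalEquality
open import Relation.Nullary using (¬_; Dec; yes; no; contradiction)
open import Relation.Nullary.Decidable using (map′; ¬?; _×-dec_; _→-dec_; toWitness; decidable-stable)

-- Congruences modulo an integer

infix 4 _≡_[mod_]
record _≡_[mod_] (a b m : ℤ) : Set where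
  constructor ∣⇒≡-mod
  field ≡-mod⇒∣ : m ∣ a - b
open _≡_[mod_]

∣-resp : ∀ {m a b} → m ∣ a → a ≡ b → m ∣ b
∣-resp m∣a refl = m∣a

module _ {m : ℤ} where

  ≡⇒≡-mod : ∀ {a b} → a ≡ b → a ≡ b [mod m ]
  ≡⇒≡-mod {a} refl = ∣⇒≡-mod (divides 0ℤ (trans (ℤₚ.+-inverseʳ a) (sym (ℤₚ.*-zeroˡ m))))

  ≡-mod-refl : ∀ {a} → a ≡ a [mod m ]
  ≡-mod-refl = ≡⇒≡-mod refl

  ≡-mod-sym : ∀ {a b} → a ≡ b [mod m ] → b ≡ a [mod m ]
  ≡-mod-sym {a} {b} (∣⇒≡-mod m∣a-b) = ∣⇒≡-mod (∣-resp (∣m⇒∣-m m∣a-b) (identity a b))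
    where
    identity : ∀ a b → - (a - b) ≡ b - a
    identity = solve-∀

  ≡-mod-trans : ∀ {a b c} → a ≡ b [mod m ] → b ≡ c [mod m ] → a ≡ c [mod m ]
  ≡-mod-trans {a} {b} {c} (∣⇒≡-mod m∣a-b) (∣⇒≡-mod m∣b-c) =
    ∣⇒≡-mod (∣-resp (∣m∣n⇒∣m+n m∣a-b m∣b-c) (identity a b c))
    where
    identity : ∀ a b c → (a - b) + (b - c) ≡ a - c
    identity = solve-∀

  +-cong-mod : ∀ {a b c d} → a ≡ b [mod m ] → c ≡ d [mod m ] → a + c ≡ b + d [mod m ]
  +-cong-mod {a} {b} {c} {d} (∣⇒≡-mod m∣a-b) (∣⇒≡-mod m∣c-d) =
    ∣⇒≡-mod (∣-resp (∣m∣n⇒∣m+n m∣a-b m∣c-d) (identity a b c d))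
    where
    identity : ∀ a b c d → (a - b) + (c - d) ≡ (a + c) - (b + d)
    identity = solve-∀

  *-cong-mod : ∀ {a b c d} → a ≡ b [mod m ] → c ≡ d [mod m ] → a * c ≡ b * d [mod m ]
  *-cong-mod {a} {b} {c} {d} (∣⇒≡-mod m∣a-b) (∣⇒≡-mod m∣c-d) =
    ∣⇒≡-mod (∣-resp (∣m∣n⇒∣m+n (∣n⇒∣m*n c m∣a-b) (∣n⇒∣m*n b m∣c-d)) (identity a b c d))
    where
    identity : ∀ a b c d → c * (a - b) + b * (c - d) ≡ a * c - b * d
    identity = solve-∀

  +-congˡ-mod : ∀ a {b c} → b ≡ c [mod m ] → a + b ≡ a + c [mod m ]
  +-congˡ-mod a = +-cong-mod (≡-mod-refl {a})

  *-congˡ-mod : ∀ a {b c} → b ≡ c [mod m ] → a * b ≡ a * c [mod m ]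
  *-congˡ-mod a = *-cong-mod (≡-mod-refl {a})

  *-congʳ-mod : ∀ c {a b} → a ≡ b [mod m ] → a * c ≡ b * c [mod m ]
  *-congʳ-mod c a≡b = *-cong-mod a≡b (≡-mod-refl {c})

≡-mod-setoid : ℤ → Setoid _ _
≡-mod-setoid m = record
  { _≈_ = _≡_[mod m ]
  ; isEquivalence = record { refl = ≡⇒≡-mod refl ; sym = ≡-mod-sym ; trans = ≡-mod-trans } }

module ≡-mod-Reasoning (m : ℤ) where
  open import Relation.Binary.Reasoning.Setoid (≡-mod-setoid m) public

infix 4 _≡?_[mod_]
_≡?_[mod_] : ∀ a b m → Dec (a ≡ b [mod m ])
a ≡? b [mod m ] = map′ ∣⇒≡-mod ≡-mod⇒∣ (m ∣? a - b)

≡-mod-∣ : ∀ {d m a b} → d ∣ m → a ≡ b [mod m ] → d ∣ b → d ∣ a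
≡-mod-∣ {a = a} {b} d∣m (∣⇒≡-mod m∣a-b) d∣b = ∣-resp (∣m∣n⇒∣m+n (∣-trans d∣m m∣a-b) d∣b) (identity a b)
  where
  identity : ∀ a b → a - b + b ≡ a
  identity = solve-∀

∣i∣*∣i∣≡i*i : ∀ i → + ℤ.∣ i ∣ * + ℤ.∣ i ∣ ≡ i * i
∣i∣*∣i∣≡i*i i with ℤₚ.+∣i∣≡i⊎+∣i∣≡-i i
... | inj₁ ∣i∣≡i  = cong₂ _*_ ∣i∣≡i ∣i∣≡i
... | inj₂ ∣i∣≡-i = trans (cong₂ _*_ ∣i∣≡-i ∣i∣≡-i) (identity i)
  where
  identity : ∀ i → - i * - i ≡ i * i
  identity = solve-∀

≡-mod-residue : ∀ y p .{{_ : NonZero p}} → y ≡ + (y ℤ.%ℕ p) [mod + p ]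
≡-mod-residue y p = ∣⇒≡-mod (divides (y ℤ./ℕ p) (begin
  y - + r                    ≡⟨ cong (_- + r) (a≡a%ℕn+[a/ℕn]*n y p) ⟩
  + r + y ℤ./ℕ p * + p - + r ≡⟨ identity (+ r) (y ℤ./ℕ p) (+ p) ⟩
  y ℤ./ℕ p * + p             ∎))
  where
  open ≡-Reasoning
  r = y ℤ.%ℕ p
  identity : ∀ r q p → r + q * p - r ≡ q * p
  identity = solve-∀

⟨_⟩ : ∀ {n} → Fin n → ℤ
⟨ i ⟩ = + toℕ i

⟨_⟩² : ∀ {n} → Fin n → ℤ
⟨ i ⟩² = ⟨ i ⟩ * ⟨ i ⟩

residue : ∀ p .{{_ : NonZero p}} → ℤ → Fin p
residue p y = fromℕ< (n%ℕd<d y p)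

⟨residue⟩≡ : ∀ p .{{_ : NonZero p}} y → ⟨ residue p y ⟩ ≡ y [mod + p ]
⟨residue⟩≡ p y =
  subst (λ r → + r ≡ y [mod + p ]) (sym (toℕ-fromℕ< (n%ℕd<d y p))) (≡-mod-sym (≡-mod-residue y p))

≡-mod⇒≡ : ∀ {p m n} → m < p → n < p → + m ≡ + n [mod + p ] → m ≡ n
≡-mod⇒≡ {p} {m} {n} m<p n<p (∣⇒≡-mod p∣m-n) =
  ℤₚ.+-injective (ℤₚ.i-j≡0⇒i≡j (+ m) (+ n) (ℤₚ.∣i∣≡0⇒i≡0 ∣m-n∣≡0))
  where
  ∣m-n∣<p : ℤ.∣ + m - + n ∣ < p
  ∣m-n∣<p = subst (_< p) (cong ℤ.∣_∣ (sym (ℤₚ.m-n≡m⊖n m n)))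
    (ℕₚ.≤-<-trans (ℤₚ.∣m⊝n∣≤m⊔n m n) (ℕₚ.⊔-lub m<p n<p))
  ∣m-n∣≡0 : ℤ.∣ + m - + n ∣ ≡ 0
  ∣m-n∣≡0 with ℤ.∣ + m - + n ∣ in eq
  ... | zero  = refl
  ... | suc _ = contradiction (ℕᵈ.∣⇒≤ (subst (p ℕᵈ.∣_) eq (∣⇒∣ᵤ p∣m-n))) (ℕₚ.<⇒≱ (subst (_< p) eq ∣m-n∣<p))

prime⇒>1 : ∀ {p} → Prime p → 1 < p
prime⇒>1 {p} p-prime = ℕ.nonTrivial⇒n>1 p {{prime⇒nonTrivial p-prime}}

prime∣*⇒∣⊎∣ : ∀ {p} x y → Prime p → + p ∣ x * y → + p ∣ x ⊎ + p ∣ y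
prime∣*⇒∣⊎∣ x y p-prime p∣xy =
  Sum.map ∣ᵤ⇒∣ ∣ᵤ⇒∣ (euclidsLemma ℤ.∣ x ∣ ℤ.∣ y ∣ p-prime (subst (_ ℕᵈ.∣_) (ℤₚ.abs-* x y) (∣⇒∣ᵤ p∣xy)))

prime∣²⇒∣ : ∀ {p} x → Prime p → + p ∣ x * x → + p ∣ x
prime∣²⇒∣ x p-prime p∣x² = Sum.reduce (prime∣*⇒∣⊎∣ x x p-prime p∣x²)

prime∤⇒coprime : ∀ {p n} → Prime p → ¬ p ℕᵈ.∣ n → Coprime p n
prime∤⇒coprime p-prime p∤n (d∣p , d∣n) with prime⇒irreducible p-prime d∣p
... | inj₁ d≡1 = d≡1
... | inj₂ refl = contradiction d∣n p∤n

2∣prime⇒≡2 : ∀ {p} → Prime p → 2 ℕᵈ.∣ p → p ≡ 2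
2∣prime⇒≡2 p-prime 2∣p with prime⇒irreducible p-prime 2∣p
... | inj₂ 2≡p = sym 2≡p

prime∣2⇒≡2 : ∀ {p} → Prime p → p ℕᵈ.∣ 2 → p ≡ 2
prime∣2⇒≡2 p-prime p∣2 = ℕₚ.≤-antisym (ℕᵈ.∣⇒≤ p∣2) (prime⇒>1 p-prime)

odd-prime∤8 : ∀ {p} → Prime p → p ≢ 2 → ¬ p ℕᵈ.∣ 8
odd-prime∤8 p-prime p≢2 p∣2*4 = p≢2 (prime∣2⇒≡2 p-prime
  (Sum.reduce (Sum.map₂ (Sum.reduce ∘ euclidsLemma 2 2 p-prime) (euclidsLemma 2 4 p-prime p∣2*4))))

m≤n⇒m∣n! : ∀ {m n} .{{_ : NonZero m}} → m ≤ n → m ℕᵈ.∣ n !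
m≤n⇒m∣n! {suc m} m≤n = ℕᵈ.∣-trans (ℕᵈ.m∣m*n (m !)) (ℕᵈ.m≤n⇒m!∣n! m≤n)

prime∤n! : ∀ {p} n → Prime p → n < p → ¬ p ℕᵈ.∣ n !
prime∤n! zero    p-prime _     p∣1 = ℕₚ.<⇒≢ (prime⇒>1 p-prime) (sym (ℕᵈ.∣1⇒≡1 p∣1))
prime∤n! (suc n) p-prime 1+n<p p∣[1+n]! with euclidsLemma (suc n) (n !) p-prime p∣[1+n]!
... | inj₁ p∣1+n = ℕₚ.<⇒≱ 1+n<p (ℕᵈ.∣⇒≤ p∣1+n)
... | inj₂ p∣n!  = prime∤n! n p-prime (ℕₚ.<-trans (ℕₚ.n<1+n n) 1+n<p) p∣n!

odd-prime∤8*n! : ∀ {p} n → Prime p → p ≢ 2 → n < p → ¬ p ℕᵈ.∣ 8 ℕ.* n !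
odd-prime∤8*n! n p-prime p≢2 n<p p∣8*n! =
  Sum.[ odd-prime∤8 p-prime p≢2 , prime∤n! n p-prime n<p ] (euclidsLemma 8 (n !) p-prime p∣8*n!)

∃-prime-factor : ∀ n → 1 < n → ∃ λ p → Prime p × p ℕᵈ.∣ n
∃-prime-factor n@(suc _) 1<n with factorise n
... | record { factors = [] ; isFactorisation = n≡1 } = contradiction n≡1 (ℕₚ.>⇒≢ 1<n)
... | record { factors = p ∷ _ ; isFactorisation = n≡p*_ ; factorsPrime = p-prime All.∷ _ } =
  p , p-prime , subst (p ℕᵈ.∣_) (sym n≡p*_) (ℕᵈ.m∣m*n _)

∃-odd-prime-factor : ∀ n → 2 < n → ¬ 4 ℕᵈ.∣ n → ∃ λ p → Prime p × p ≢ 2 × p ℕᵈ.∣ n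
∃-odd-prime-factor n 2<n 4∤n with 2 ℕᵈ.∣? n
... | no 2∤n with p , p-prime , p∣n ← ∃-prime-factor n (ℕₚ.<-trans (s≤s (s≤s z≤n)) 2<n) =
  p , p-prime , (λ { refl → 2∤n p∣n }) , p∣n
... | yes (ℕᵈ.divides o refl) with p , p-prime , p∣o ← ∃-prime-factor o (ℕₚ.*-cancelʳ-< 2 1 o 2<n) =
  p , p-prime , (λ { refl → 4∤n (ℕᵈ.*-monoˡ-∣ 2 p∣o) }) , ℕᵈ.∣m⇒∣m*n 2 p∣o

pos-1+*≡* : ∀ a b c d → 1 ℕ.+ a ℕ.* b ≡ c ℕ.* d → 1ℤ + + a * + b ≡ + c * + d
pos-1+*≡* a b c d eq = begin
  1ℤ + + a * + b     ≡⟨ cong (λ t → 1ℤ + t) (ℤₚ.pos-* a b) ⟨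
  + (1 ℕ.+ a ℕ.* b)  ≡⟨ cong +_ eq ⟩
  + (c ℕ.* d)        ≡⟨ ℤₚ.pos-* c d ⟩
  + c * + d          ∎
  where open ≡-Reasoning

∃-inverse-mod-ℕ : ∀ {p n} → Prime p → ¬ p ℕᵈ.∣ n → ∃ λ s → s * + n ≡ 1ℤ [mod + p ]
∃-inverse-mod-ℕ {p} {n} p-prime p∤n with coprime-Bézout (prime∤⇒coprime p-prime p∤n)
... | Bézout.+- x y 1+yn≡xp =
  - + y , ∣⇒≡-mod (divides (- + x) (-y*n-1≡-x*p (+ x) (+ y) (+ n) (+ p) (pos-1+*≡* y n x p 1+yn≡xp)))
  where
  -y*n-1≡-x*p : ∀ x y n p → 1ℤ + y * n ≡ x * p → - y * n - 1ℤ ≡ - x * p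
  -y*n-1≡-x*p x y n p 1+yn≡xp = begin
    - y * n - 1ℤ   ≡⟨ solve (y ∷ n ∷ []) ⟩
    - (1ℤ + y * n) ≡⟨ cong -_ 1+yn≡xp ⟩
    - (x * p)      ≡⟨ ℤₚ.neg-distribˡ-* x p ⟩
    - x * p        ∎
    where open ≡-Reasoning
... | Bézout.-+ x y 1+xp≡yn =
  + y , ∣⇒≡-mod (divides (+ x) (y*n-1≡x*p (+ x) (+ y) (+ n) (+ p) (pos-1+*≡* x p y n 1+xp≡yn)))
  where
  y*n-1≡x*p : ∀ x y n p → 1ℤ + x * p ≡ y * n → y * n - 1ℤ ≡ x * p
  y*n-1≡x*p x y n p 1+xp≡yn = begin
    y * n - 1ℤ        ≡⟨ cong (_- 1ℤ) 1+xp≡yn ⟨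
    1ℤ + x * p - 1ℤ   ≡⟨ solve (x ∷ p ∷ []) ⟩
    x * p             ∎
    where open ≡-Reasoning

-- If s inverts ∣ w ∣ then s² w inverts w, because w (s² w) = (s ∣ w ∣)².
∃-inverse-mod : ∀ {p} w → Prime p → ¬ + p ∣ w → ∃ λ w′ → w * w′ ≡ 1ℤ [mod + p ]
∃-inverse-mod {p} w p-prime p∤w with ∃-inverse-mod-ℕ p-prime (p∤w ∘ ∣ᵤ⇒∣)
... | s , s∣w∣≡1 = s * s * w , (begin
  w * (s * s * w)                  ≡⟨ solve (w ∷ s ∷ []) ⟩
  s * s * (w * w)                  ≡⟨ cong (s * s *_) (∣i∣*∣i∣≡i*i w) ⟨
  s * s * (+ ℤ.∣ w ∣ * + ℤ.∣ w ∣)    ≡⟨ identity s (+ ℤ.∣ w ∣) ⟩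
  (s * + ℤ.∣ w ∣) * (s * + ℤ.∣ w ∣)  ≈⟨ *-cong-mod s∣w∣≡1 s∣w∣≡1 ⟩
  1ℤ * 1ℤ                          ≡⟨⟩
  1ℤ                               ∎)
  where
  open ≡-mod-Reasoning (+ p)
  identity : ∀ s a → s * s * (a * a) ≡ (s * a) * (s * a)
  identity = solve-∀

∃-solution-mod : ∀ {p m} → Prime p → ¬ + p ∣ + m → ∀ u r → ∃ λ j → + (u ℕ.+ m ℕ.* j) ≡ r [mod + p ]
∃-solution-mod {p} {m} p-prime p∤m u r = j , (begin
  + (u ℕ.+ m ℕ.* j)                ≡⟨ cong (_+_ (+ u)) (ℤₚ.pos-* m j) ⟩
  + u + + m * + j                  ≈⟨ +-congˡ-mod (+ u) (*-congˡ-mod (+ m) (≡-mod-sym (≡-mod-residue j′ p))) ⟩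
  + u + + m * j′                   ≡⟨ cong (_+_ (+ u)) (ℤₚ.*-assoc (+ m) m′ (r - + u)) ⟨
  + u + (+ m * m′) * (r - + u)     ≈⟨ +-congˡ-mod (+ u) (*-congʳ-mod (r - + u) mm′≡1) ⟩
  + u + 1ℤ * (r - + u)             ≡⟨ identity (+ u) r ⟩
  r                                ∎)
  where
  instance _ = prime⇒nonZero p-prime
  open ≡-mod-Reasoning (+ p)
  m′ = proj₁ (∃-inverse-mod (+ m) p-prime p∤m)
  mm′≡1 = proj₂ (∃-inverse-mod (+ m) p-prime p∤m)
  j′ = m′ * (r - + u)
  j = j′ ℤ.%ℕ p
  identity : ∀ u r → u + 1ℤ * (r - u) ≡ r
  identity = solve-∀

+-≡-mod : ∀ {d} u k → d ℕᵈ.∣ k → + (u ℕ.+ k) ≡ + u [mod + d ]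
+-≡-mod u k d∣k = ∣⇒≡-mod (∣-resp (∣ᵤ⇒∣ d∣k) (sym (identity (+ u) (+ k))))
  where
  identity : ∀ u k → u + k - u ≡ k
  identity = solve-∀

-- Quadratic nonresidues

y+y≡y*2 : ∀ y → y ℕ.+ y ≡ y ℕ.* 2
y+y≡y*2 y = trans (cong (y ℕ.+_) (sym (ℕₚ.+-identityʳ y))) (ℕₚ.*-comm 2 y)

m+m<n⇒m<⌈n/2⌉ : ∀ m n → m ℕ.+ m < n → m < ⌈ n /2⌉
m+m<n⇒m<⌈n/2⌉ zero    (suc n)       _                       = s≤s z≤n
m+m<n⇒m<⌈n/2⌉ (suc m) (suc (suc n)) (s≤s (s≤s m+[1+m]≤n)) =
  s≤s (m+m<n⇒m<⌈n/2⌉ m n (subst (_≤ n) (ℕₚ.+-suc m m) m+[1+m]≤n))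

1<n⇒⌈n/2⌉<n : ∀ {n} → 1 < n → ⌈ n /2⌉ < n
1<n⇒⌈n/2⌉<n {suc (suc n)} (s≤s (s≤s _)) = ℕₚ.⌈n/2⌉<n n

NonResidue : ℕ → ℤ → Set
NonResidue p u = ∀ y → ¬ (y * y ≡ u [mod + p ])

nonResidue-resp : ∀ {p u v} → v ≡ u [mod + p ] → NonResidue p u → NonResidue p v
nonResidue-resp v≡u u-nonResidue y y²≡v = u-nonResidue y (≡-mod-trans y²≡v v≡u)

nonResidue⇒≢*square : ∀ {p u} w x → Prime p → NonResidue p u → ¬ + p ∣ w →
                      ¬ (x * x ≡ u * w * w [mod + p ])
nonResidue⇒≢*square {p} {u} w x p-prime u-nonResidue p∤w x²≡uw² = u-nonResidue (x * w′) (begin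
  (x * w′) * (x * w′)       ≡⟨ identity₁ x w′ ⟩
  (x * x) * (w′ * w′)       ≈⟨ *-congʳ-mod (w′ * w′) x²≡uw² ⟩
  u * w * w * (w′ * w′)     ≡⟨ identity₂ u w w′ ⟩
  u * ((w * w′) * (w * w′)) ≈⟨ *-congˡ-mod u (*-cong-mod ww′≡1 ww′≡1) ⟩
  u * (1ℤ * 1ℤ)             ≡⟨ ℤₚ.*-identityʳ u ⟩
  u                         ∎)
  where
  open ≡-mod-Reasoning (+ p)
  w′ = proj₁ (∃-inverse-mod w p-prime p∤w)
  ww′≡1 = proj₂ (∃-inverse-mod w p-prime p∤w)
  identity₁ : ∀ x w′ → (x * w′) * (x * w′) ≡ (x * x) * (w′ * w′)
  identity₁ = solve-∀
  identity₂ : ∀ u w w′ → u * w * w * (w′ * w′) ≡ u * ((w * w′) * (w * w′))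
  identity₂ = solve-∀

square≡square-of-complement : ∀ {p} y z → z + y ≡ p → z * z ≡ y * y [mod p ]
square≡square-of-complement y z refl = ∣⇒≡-mod (divides (z - y) (identity y z))
  where
  identity : ∀ y z → z * z - y * y ≡ (z - y) * (z + y)
  identity = solve-∀

∃-small-root : ∀ {p} → Prime p → p ≢ 2 → ∀ y → y < p →
               ∃ λ z → z ℕ.+ z < p × + z * + z ≡ + y * + y [mod + p ]
∃-small-root {p} p-prime p≢2 y y<p with y ℕ.+ y <? p
... | yes y+y<p = y , y+y<p , ≡-mod-refl
... | no  y+y≮p = z , z+z<p , square≡square-of-complement (+ y) (+ z) (cong +_ z+y≡p)
  where
  z = p ∸ y
  z+y≡p : z ℕ.+ y ≡ p
  z+y≡p = ℕₚ.m∸n+n≡m (ℕₚ.<⇒≤ y<p)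
  p<y+y : p < y ℕ.+ y
  p<y+y = ℕₚ.≤∧≢⇒< (ℕₚ.≮⇒≥ y+y≮p)
    (λ p≡y+y → p≢2 (2∣prime⇒≡2 p-prime (ℕᵈ.divides y (trans p≡y+y (y+y≡y*2 y)))))
  z+z<p : z ℕ.+ z < p
  z+z<p = subst (z ℕ.+ z <_) z+y≡p
    (ℕₚ.+-monoʳ-< z (ℕₚ.+-cancelʳ-< y z y (subst (_< y ℕ.+ y) (sym z+y≡p) p<y+y)))

-- Were every residue a square, choosing square roots in [0, p/2) would inject Fin p into
-- Fin ⌈ p /2⌉.
∃-nonResidue : ∀ {p} → Prime p → p ≢ 2 → ∃ (NonResidue p)
∃-nonResidue {p} p-prime p≢2 with any? (λ r → all? (λ y → ¬? (⟨ y ⟩² ≡? ⟨ r ⟩ [mod + p ])))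
... | yes (r , r-nonResidue) = ⟨ r ⟩ , λ y y²≡r → r-nonResidue (residue p y) (begin
  ⟨ residue p y ⟩² ≈⟨ *-cong-mod (⟨residue⟩≡ p y) (⟨residue⟩≡ p y) ⟩
  y * y           ≈⟨ y²≡r ⟩
  ⟨ r ⟩           ∎)
  where
  open ≡-mod-Reasoning (+ p)
  instance _ = prime⇒nonZero p-prime
... | no ∄nonResidue =
  contradiction (injective⇒≤ small-root-injective) (ℕₚ.<⇒≱ (1<n⇒⌈n/2⌉<n (prime⇒>1 p-prime)))
  where
  square-root : ∀ r → ∃ λ y → ⟨ y ⟩² ≡ ⟨ r ⟩ [mod + p ]
  square-root r
    with y , ¬¬y²≡r ← ¬∀⟶∃¬ p _ (λ y → ¬? (⟨ y ⟩² ≡? ⟨ r ⟩ [mod + p ])) (λ ∀y → ∄nonResidue (r , ∀y))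
    = y , decidable-stable (⟨ y ⟩² ≡? ⟨ r ⟩ [mod + p ]) ¬¬y²≡r
  small-root : ∀ r → ∃ λ z → z ℕ.+ z < p × + z * + z ≡ ⟨ r ⟩ [mod + p ]
  small-root r
    with y , y²≡r ← square-root r
    with z , z+z<p , z²≡y² ← ∃-small-root p-prime p≢2 (toℕ y) (toℕ<n y)
    = z , z+z<p , ≡-mod-trans z²≡y² y²≡r
  small-root<⌈p/2⌉ : ∀ r → proj₁ (small-root r) < ⌈ p /2⌉
  small-root<⌈p/2⌉ r = m+m<n⇒m<⌈n/2⌉ _ p (proj₁ (proj₂ (small-root r)))
  small-root-injective : Injective _≡_ _≡_ (λ r → fromℕ< (small-root<⌈p/2⌉ r))
  small-root-injective {r} {s} root[r]≡root[s] = toℕ-injective (≡-mod⇒≡ (toℕ<n r) (toℕ<n s) (begin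
    ⟨ r ⟩                  ≈⟨ ≡-mod-sym (proj₂ (proj₂ (small-root r))) ⟩
    + zr * + zr            ≡⟨ cong (λ z → + z * + z) zr≡zs ⟩
    + zs * + zs            ≈⟨ proj₂ (proj₂ (small-root s)) ⟩
    ⟨ s ⟩                  ∎))
    where
    open ≡-mod-Reasoning (+ p)
    zr = proj₁ (small-root r)
    zs = proj₁ (small-root s)
    zr≡zs : zr ≡ zs
    zr≡zs = trans (sym (toℕ-fromℕ< (small-root<⌈p/2⌉ r)))
                  (trans (cong toℕ root[r]≡root[s]) (toℕ-fromℕ< (small-root<⌈p/2⌉ s)))

-- The multiplier u

record Admissible (B u : ℕ) : Set where
  field
    ≡7-mod-8   : + u ≡ + 7 [mod + 8 ]
    nonResidue : ∀ {p} → Prime p → p ≢ 2 → p ≤ B → NonResidue p (+ u)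

-- Adding a multiple of 8 · n ! changes u neither modulo 8 nor modulo any odd prime p ≤ n; the
-- multiple is chosen to make u congruent to a nonresidue modulo suc n.
admissible-extend : ∀ {n u r} → Admissible n u → Prime (suc n) → suc n ≢ 2 → NonResidue (suc n) r →
                    ∃ (Admissible (suc n))
admissible-extend {n} {u} {r} u-admissible P-prime P≢2 r-nonResidue =
  u′ , record { ≡7-mod-8 = ≡-mod-trans (+-≡-mod u (M ℕ.* j) 8∣Mj) ≡7-mod-8 ; nonResidue = nonResidue′ }
  where
  open Admissible u-admissible
  M = 8 ℕ.* n !
  j = proj₁ (∃-solution-mod P-prime (odd-prime∤8*n! n P-prime P≢2 (ℕₚ.n<1+n n) ∘ ∣⇒∣ᵤ) u r)
  u′ = u ℕ.+ M ℕ.* j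
  u′≡r : + u′ ≡ r [mod + suc n ]
  u′≡r = proj₂ (∃-solution-mod P-prime (odd-prime∤8*n! n P-prime P≢2 (ℕₚ.n<1+n n) ∘ ∣⇒∣ᵤ) u r)
  8∣Mj : 8 ℕᵈ.∣ M ℕ.* j
  8∣Mj = ℕᵈ.∣m⇒∣m*n j (ℕᵈ.m∣m*n (n !))
  nonResidue′ : ∀ {p} → Prime p → p ≢ 2 → p ≤ suc n → NonResidue p (+ u′)
  nonResidue′ p-prime p≢2 p≤1+n with ℕₚ.m≤n⇒m<n∨m≡n p≤1+n
  ... | inj₂ refl  = nonResidue-resp u′≡r r-nonResidue
  ... | inj₁ p<1+n = nonResidue-resp (+-≡-mod u (M ℕ.* j) p∣Mj) (nonResidue p-prime p≢2 (ℕₚ.≤-pred p<1+n))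
    where
    instance _ = prime⇒nonZero p-prime
    p∣Mj = ℕᵈ.∣m⇒∣m*n j (ℕᵈ.∣n⇒∣m*n 8 (m≤n⇒m∣n! (ℕₚ.≤-pred p<1+n)))

admissible-step : ∀ {n u} → Admissible n u → ∃ (Admissible (suc n))
admissible-step {n} {u} u-admissible with prime? (suc n) ×-dec ¬? (suc n ℕ.≟ 2)
... | yes (P-prime , P≢2) = admissible-extend u-admissible P-prime P≢2 (proj₂ (∃-nonResidue P-prime P≢2))
... | no ¬odd-prime = u , record { ≡7-mod-8 = ≡7-mod-8 ; nonResidue = nonResidue′ }
  where
  open Admissible u-admissible
  nonResidue′ : ∀ {p} → Prime p → p ≢ 2 → p ≤ suc n → NonResidue p (+ u)
  nonResidue′ p-prime p≢2 p≤1+n with ℕₚ.m≤n⇒m<n∨m≡n p≤1+n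
  ... | inj₁ p<1+n = nonResidue p-prime p≢2 (ℕₚ.≤-pred p<1+n)
  ... | inj₂ refl  = contradiction (p-prime , p≢2) ¬odd-prime

∃-admissible : ∀ B → ∃ (Admissible B)
∃-admissible zero    =
  7 , record { ≡7-mod-8 = ≡-mod-refl ; nonResidue = λ p-prime _ p≤0 → contradiction p≤0 (p≰0 p-prime) }
  where
  p≰0 : ∀ {p} → Prime p → ¬ p ≤ 0
  p≰0 p-prime = ℕₚ.<⇒≱ (ℕₚ.<-trans z<s (prime⇒>1 p-prime))
∃-admissible (suc B) = admissible-step (proj₂ (∃-admissible B))

admissible⇒nonZero : ∀ {B u} → Admissible B u → NonZero u
admissible⇒nonZero {u = zero} u-admissible =
  contradiction (≡-mod⇒≡ z<s (ℕₚ.n<1+n 7) (Admissible.≡7-mod-8 u-admissible)) λ ()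
admissible⇒nonZero {u = suc _} _ = _

-- The equation u W² = X² + D Z²

record NormEquation (u D W X Z : ℤ) : Set where
  constructor mkNormEquation
  field equation : u * W * W ≡ X * X + D * Z * Z

normEquation-cancel : ∀ {u D} m .{{_ : ℤ.NonZero m}} W X Z →
                      NormEquation u D (W * m) (X * m) (Z * m) → NormEquation u D W X Z
normEquation-cancel {u} {D} m W X Z (mkNormEquation eq) =
  mkNormEquation (ℤₚ.*-cancelˡ-≡ (m * m) _ _ {{ℤₚ.i*j≢0 m m}} (begin
  m * m * (u * W * W)                     ≡⟨ solve (m ∷ u ∷ W ∷ []) ⟩
  u * (W * m) * (W * m)                   ≡⟨ eq ⟩
  X * m * (X * m) + D * (Z * m) * (Z * m) ≡⟨ solve (m ∷ X ∷ D ∷ Z ∷ []) ⟩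
  m * m * (X * X + D * Z * Z)             ∎))
  where open ≡-Reasoning

descent : ∀ {u D} m → 1 < m →
          (∀ {W X Z} → NormEquation u D W X Z → + m ∣ W × + m ∣ X × + m ∣ Z) →
          ∀ {W X Z} → NormEquation u D W X Z → W ≡ 0ℤ
descent {u} {D} m 1<m divisible {W} {X} {Z} = go (suc ℤ.∣ W ∣) {W} {X} {Z} ℕₚ.≤-refl
  where
  instance _ = ℕ.>-nonZero (ℕₚ.<-trans z<s 1<m)
  go : ∀ n {W X Z} → ℤ.∣ W ∣ < n → NormEquation u D W X Z → W ≡ 0ℤ
  go (suc n) {W} {X} {Z} ∣W∣<1+n eq with W ℤ.≟ 0ℤ | divisible eq
  ... | yes W≡0 | _ = W≡0
  ... | no W≢0  | divides W′ refl , divides X′ refl , divides Z′ refl =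
    cong (_* + m) (go n ∣W′∣<n (normEquation-cancel (+ m) W′ X′ Z′ eq))
    where
    instance
      _ = ℕ.≢-nonZero {ℤ.∣ W′ ∣} (λ ∣W′∣≡0 → W≢0 (cong (_* + m) (ℤₚ.∣i∣≡0⇒i≡0 {W′} ∣W′∣≡0)))
    ∣W′∣<n : ℤ.∣ W′ ∣ < n
    ∣W′∣<n = ℕₚ.<-≤-trans (subst (ℤ.∣ W′ ∣ <_) (sym (ℤₚ.abs-* W′ (+ m))) (ℕₚ.m<m*n ℤ.∣ W′ ∣ m 1<m))
                          (ℕₚ.≤-pred ∣W∣<1+n)

normEquation-square : ∀ {u q e W X Z} → NormEquation u (q * (e * e)) W X Z → NormEquation u q W X (e * Z)
normEquation-square {u} {q} {e} {W} {X} {Z} (mkNormEquation eq) = mkNormEquation (begin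
  u * W * W                       ≡⟨ eq ⟩
  X * X + q * (e * e) * Z * Z     ≡⟨ solve (X ∷ q ∷ e ∷ Z ∷ []) ⟩
  X * X + q * (e * Z) * (e * Z)   ∎)
  where open ≡-Reasoning

normEquation⇒≡-mod : ∀ {u q m W X Z} → NormEquation u (q * m) W X Z → X * X ≡ u * W * W [mod q ]
normEquation⇒≡-mod {u} {q} {m} {W} {X} {Z} (mkNormEquation eq) = ∣⇒≡-mod (divides (- (m * Z * Z)) (begin
  X * X - u * W * W               ≡⟨ cong (λ t → X * X - t) eq ⟩
  X * X - (X * X + q * m * Z * Z) ≡⟨ solve (X ∷ q ∷ m ∷ Z ∷ []) ⟩
  - (m * Z * Z) * q               ∎))
  where open ≡-Reasoning

prime∣Z : ∀ {p u m W X Z} → Prime p → ¬ + p ∣ m → + p ∣ W → + p ∣ X →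
          NormEquation u (+ p * m) W X Z → + p ∣ Z
prime∣Z {p} {u} {m} {_} {_} {Z} p-prime p∤m (divides W refl) (divides X refl) (mkNormEquation eq) =
  prime∣²⇒∣ Z p-prime (Sum.fromInj₂ (λ p∣m → contradiction p∣m p∤m) (prime∣*⇒∣⊎∣ m (Z * Z) p-prime p∣mZ²))
  where
  rearranged : ∀ u W X q m Z → u * (W * q) * (W * q) ≡ X * q * (X * q) + q * m * Z * Z →
               q * (m * (Z * Z)) ≡ q * ((u * W * W - X * X) * q)
  rearranged u W X q m Z eq = begin
    q * (m * (Z * Z))                                 ≡⟨ solve (X ∷ q ∷ m ∷ Z ∷ []) ⟩
    X * q * (X * q) + q * m * Z * Z - X * q * (X * q) ≡⟨ cong (λ t → t - X * q * (X * q)) eq ⟨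
    u * (W * q) * (W * q) - X * q * (X * q)           ≡⟨ solve (u ∷ W ∷ X ∷ q ∷ []) ⟩
    q * ((u * W * W - X * X) * q)                     ∎
    where open ≡-Reasoning
  p∣mZ² : + p ∣ m * (Z * Z)
  p∣mZ² = divides (u * W * W - X * X)
    (ℤₚ.*-cancelˡ-≡ (+ p) _ _ {{prime⇒nonZero p-prime}} (rearranged u W X (+ p) m Z eq))

odd-prime-divides : ∀ {p u m W X Z} → Prime p → NonResidue p u → ¬ + p ∣ m →
                    NormEquation u (+ p * m) W X Z → + p ∣ W × + p ∣ X × + p ∣ Z
odd-prime-divides {p} {u} {m} {W} {X} {Z} p-prime u-nonResidue p∤m eq =
  p∣W , p∣X , prime∣Z p-prime p∤m p∣W p∣X eq
  where
  p∣W : + p ∣ W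
  p∣W = decidable-stable (+ p ∣? W)
    (λ p∤W → nonResidue⇒≢*square W X p-prime u-nonResidue p∤W (normEquation⇒≡-mod eq))
  p∣X : + p ∣ X
  p∣X = prime∣²⇒∣ X p-prime (≡-mod-∣ ∣-refl (normEquation⇒≡-mod eq) (∣n⇒∣m*n (u * W) p∣W))

Mod8Obstruction : ℤ → Set
Mod8Obstruction D = ∀ (w x z : Fin 8) →
  + 7 * ⟨ w ⟩² ≡ ⟨ x ⟩² + D * ⟨ z ⟩² [mod + 8 ] → + 2 ∣ ⟨ w ⟩ × + 2 ∣ ⟨ x ⟩ × + 2 ∣ ⟨ z ⟩

mod8Obstruction? : ∀ D → Dec (Mod8Obstruction D)
mod8Obstruction? D = all? λ w → all? λ x → all? λ z →
  (+ 7 * ⟨ w ⟩² ≡? ⟨ x ⟩² + D * ⟨ z ⟩² [mod + 8 ]) →-dec (+ 2 ∣? ⟨ w ⟩ ×-dec + 2 ∣? ⟨ x ⟩ ×-dec + 2 ∣? ⟨ z ⟩)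

mod8Obstruction : ∀ {D} → D ≡ + 1 ⊎ D ≡ + 2 → Mod8Obstruction D
mod8Obstruction (inj₁ refl) = toWitness {a? = mod8Obstruction? (+ 1)} _
mod8Obstruction (inj₂ refl) = toWitness {a? = mod8Obstruction? (+ 2)} _

two-divides : ∀ {u D W X Z} → u ≡ + 7 [mod + 8 ] → D ≡ + 1 ⊎ D ≡ + 2 →
              NormEquation u D W X Z → + 2 ∣ W × + 2 ∣ X × + 2 ∣ Z
two-divides {u} {D} {W} {X} {Z} u≡7 D≡1⊎D≡2 (mkNormEquation eq) =
  Product.map (lift W) (Product.map (lift X) (lift Z))
    (mod8Obstruction D≡1⊎D≡2 (residue 8 W) (residue 8 X) (residue 8 Z) (begin
      + 7 * ⟨ residue 8 W ⟩²               ≈⟨ *-congˡ-mod (+ 7) (square-residue W) ⟩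
      + 7 * (W * W)                        ≈⟨ *-congʳ-mod (W * W) (≡-mod-sym u≡7) ⟩
      u * (W * W)                          ≡⟨ ℤₚ.*-assoc u W W ⟨
      u * W * W                            ≡⟨ eq ⟩
      X * X + D * Z * Z                    ≡⟨ cong (_+_ (X * X)) (ℤₚ.*-assoc D Z Z) ⟩
      X * X + D * (Z * Z)                  ≈⟨ +-cong-mod (≡-mod-sym (square-residue X))
                                                         (*-congˡ-mod D (≡-mod-sym (square-residue Z))) ⟩
      ⟨ residue 8 X ⟩² + D * ⟨ residue 8 Z ⟩² ∎))
  where
  open ≡-mod-Reasoning (+ 8)
  square-residue : ∀ Y → ⟨ residue 8 Y ⟩² ≡ Y * Y [mod + 8 ]
  square-residue Y = *-cong-mod (⟨residue⟩≡ 8 Y) (⟨residue⟩≡ 8 Y)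
  lift : ∀ Y → + 2 ∣ ⟨ residue 8 Y ⟩ → + 2 ∣ Y
  lift Y = ≡-mod-∣ (divides (+ 4) refl) (≡-mod-sym (⟨residue⟩≡ 8 Y))

data Shape (D : ℕ) : Set where
  one      : D ≡ 1 → Shape D
  two      : D ≡ 2 → Shape D
  square   : ∀ e q → 1 < e → D ≡ q ℕ.* (e ℕ.* e) → Shape D
  oddPrime : ∀ p m → Prime p → p ≢ 2 → ¬ p ℕᵈ.∣ m → D ≡ p ℕ.* m → Shape D

shape : ∀ D → .{{NonZero D}} → Shape D
shape 1 = one refl
shape 2 = two refl
shape D@(suc (suc (suc _))) with 4 ℕᵈ.∣? D
... | yes (ℕᵈ.divides q D≡q*4) = square 2 q (s≤s (s≤s z≤n)) D≡q*4
... | no 4∤D with p , p-prime , p≢2 , ℕᵈ.divides m D≡m*p ← ∃-odd-prime-factor D (s≤s (s≤s (s≤s z≤n))) 4∤D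
  with (p ℕ.* p) ℕᵈ.∣? D
... | yes (ℕᵈ.divides q D≡q*p²) = square p q (prime⇒>1 p-prime) D≡q*p²
... | no p²∤D = oddPrime p m p-prime p≢2 p∤m (trans D≡m*p (ℕₚ.*-comm m p))
  where
  p∤m : ¬ p ℕᵈ.∣ m
  p∤m (ℕᵈ.divides k m≡k*p) =
    p²∤D (ℕᵈ.divides k (trans D≡m*p (trans (cong (ℕ._* p) m≡k*p) (ℕₚ.*-assoc k p p))))

admissible⇒trivial : ∀ {B u} → Admissible B u → ∀ D .{{_ : NonZero D}} → D ≤ B →
                     ∀ {W X Z} → NormEquation (+ u) (+ D) W X Z → W ≡ 0ℤ
admissible⇒trivial {B} {u} u-admissible D = go D (<-wellFounded D)
  where
  open Admissible u-admissible
  go : ∀ D .{{_ : NonZero D}} → Acc _<_ D → D ≤ B → ∀ {W X Z} → NormEquation (+ u) (+ D) W X Z → W ≡ 0ℤ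
  go D (acc smaller) D≤B {W} {X} {Z} eq with shape D
  ... | one refl = descent 2 (s≤s (s≤s z≤n)) (two-divides ≡7-mod-8 (inj₁ refl)) eq
  ... | two refl = descent 2 (s≤s (s≤s z≤n)) (two-divides ≡7-mod-8 (inj₂ refl)) eq
  ... | square e q 1<e refl =
    go q {{ℕₚ.m*n≢0⇒m≢0 q}} (smaller q<D) (ℕₚ.≤-trans (ℕₚ.<⇒≤ q<D) D≤B)
       (normEquation-square {q = + q} {e = + e} (subst (λ D → NormEquation (+ u) D W X Z) +D≡qe² eq))
    where
    +D≡qe² : + (q ℕ.* (e ℕ.* e)) ≡ + q * (+ e * + e)
    +D≡qe² = trans (ℤₚ.pos-* q (e ℕ.* e)) (cong (_*_ (+ q)) (ℤₚ.pos-* e e))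
    instance _ = ℕₚ.m*n≢0⇒m≢0 q
    q<D : q < q ℕ.* (e ℕ.* e)
    q<D = ℕₚ.m<m*n q (e ℕ.* e) (ℕₚ.<-≤-trans 1<e (ℕₚ.m≤m*n e e {{ℕ.>-nonZero (ℕₚ.<-trans z<s 1<e)}}))
  ... | oddPrime p m p-prime p≢2 p∤m refl =
    descent p (prime⇒>1 p-prime)
      (odd-prime-divides p-prime (nonResidue p-prime p≢2 (ℕₚ.≤-trans (ℕᵈ.∣⇒≤ (ℕᵈ.m∣m*n m)) D≤B)) (p∤m ∘ ∣⇒∣ᵤ))
      (subst (λ D → NormEquation (+ u) D W X Z) (ℤₚ.pos-* p m) eq)

-- Binary lattices

det : ℤ × ℤ → ℤ × ℤ → ℤ
det (v₁ , v₂) (w₁ , w₂) = v₁ * w₂ - v₂ * w₁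

-- The solver syntax for bilin: identities proved by solveᴾ over bilinᴾ hold definitionally for bilin.
bilinᴾ : ∀ {n} → (g₁₁ g₁₂ g₂₂ x₁ x₂ y₁ y₂ : Polynomial n) → Polynomial n
bilinᴾ g₁₁ g₁₂ g₂₂ x₁ x₂ y₁ y₂ = g₁₁ :* x₁ :* y₁ :+ g₁₂ :* x₁ :* y₂ :+ g₁₂ :* x₂ :* y₁ :+ g₂₂ :* x₂ :* y₂

detᴾ : ∀ {n} → (x₁ x₂ y₁ y₂ : Polynomial n) → Polynomial n
detᴾ x₁ x₂ y₁ y₂ = x₁ :* y₂ :- x₂ :* y₁

ratSquare : ∀ {a b} v w → w ≢ 0ℤ → w * w * + a ≡ v * v * + b → IsRatSquareQuot a b
ratSquare {a} {b} v w w≢0 w²a≡v²b = v , ℕ.pred ℤ.∣ w ∣ , (begin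
  + a * + suc (ℕ.pred ℤ.∣ w ∣) * + suc (ℕ.pred ℤ.∣ w ∣)
                                                      ≡⟨ cong (λ n → + a * + n * + n) (ℕₚ.suc-pred ℤ.∣ w ∣) ⟩
  + a * + ℤ.∣ w ∣ * + ℤ.∣ w ∣                         ≡⟨ ℤₚ.*-assoc (+ a) _ _ ⟩
  + a * (+ ℤ.∣ w ∣ * + ℤ.∣ w ∣)                       ≡⟨ cong (_*_ (+ a)) (∣i∣*∣i∣≡i*i w) ⟩
  + a * (w * w)                                       ≡⟨ ℤₚ.*-comm (+ a) (w * w) ⟩
  w * w * + a                                         ≡⟨ w²a≡v²b ⟩
  v * v * + b                                         ≡⟨ identity v (+ b) ⟩
  + b * v * v                                         ∎)
  where
  open ≡-Reasoning
  instance _ = ℤ.≢-nonZero w≢0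
  identity : ∀ v b → v * v * b ≡ b * v * v
  identity = solve-∀

module _ (g₁₁ g₁₂ g₂₂ : ℤ) where

  private
    B : ℤ × ℤ → ℤ × ℤ → ℤ
    B = bilin g₁₁ g₁₂ g₂₂

  bilin-e₁ : B (1ℤ , 0ℤ) (1ℤ , 0ℤ) ≡ g₁₁
  bilin-e₁ = solveᴾ 3 (λ g₁₁ g₁₂ g₂₂ →
    bilinᴾ g₁₁ g₁₂ g₂₂ (con 1ℤ) (con 0ℤ) (con 1ℤ) (con 0ℤ) := g₁₁) refl g₁₁ g₁₂ g₂₂

  bilin-zero : B (0ℤ , 0ℤ) (0ℤ , 0ℤ) ≡ 0ℤ
  bilin-zero = solveᴾ 3 (λ g₁₁ g₁₂ g₂₂ →
    bilinᴾ g₁₁ g₁₂ g₂₂ (con 0ℤ) (con 0ℤ) (con 0ℤ) (con 0ℤ) := con 0ℤ) refl g₁₁ g₁₂ g₂₂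

  bilin-adjugate : B (- g₁₂ , g₁₁) (- g₁₂ , g₁₁) ≡ g₁₁ * (g₁₁ * g₂₂ - g₁₂ * g₁₂)
  bilin-adjugate = solveᴾ 3 (λ g₁₁ g₁₂ g₂₂ →
    bilinᴾ g₁₁ g₁₂ g₂₂ (:- g₁₂) g₁₁ (:- g₁₂) g₁₁ := g₁₁ :* (g₁₁ :* g₂₂ :- g₁₂ :* g₁₂)) refl g₁₁ g₁₂ g₂₂

  gram-determinant : ∀ v w → B v v * B w w - B v w * B v w ≡ det v w * det v w * (g₁₁ * g₂₂ - g₁₂ * g₁₂)
  gram-determinant (v₁ , v₂) (w₁ , w₂) = solveᴾ 7 (λ g₁₁ g₁₂ g₂₂ v₁ v₂ w₁ w₂ →
    let Bᴾ = bilinᴾ g₁₁ g₁₂ g₂₂ ; d = detᴾ v₁ v₂ w₁ w₂ in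
    Bᴾ v₁ v₂ v₁ v₂ :* Bᴾ w₁ w₂ w₁ w₂ :- Bᴾ v₁ v₂ w₁ w₂ :* Bᴾ v₁ v₂ w₁ w₂ :=
      d :* d :* (g₁₁ :* g₂₂ :- g₁₂ :* g₁₂))
    refl g₁₁ g₁₂ g₂₂ v₁ v₂ w₁ w₂

  -- With k = det v w, Cramer's rule gives k x = det x w · v + det v x · w; the identity is
  -- Q v · Q (k x) with the square completed.
  discriminant-identity : ∀ v w x →
    B v v * (det v w * det v w * B x x) ≡
      (B v v * det x w + B v w * det v x) * (B v v * det x w + B v w * det v x)
      + (B v v * B w w - B v w * B v w) * (det v x * det v x)
  discriminant-identity (v₁ , v₂) (w₁ , w₂) (x₁ , x₂) = solveᴾ 9 (λ g₁₁ g₁₂ g₂₂ v₁ v₂ w₁ w₂ x₁ x₂ →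
    let Bᴾ = bilinᴾ g₁₁ g₁₂ g₂₂ ; Qv = Bᴾ v₁ v₂ v₁ v₂ ; Bvw = Bᴾ v₁ v₂ w₁ w₂
        dvw = detᴾ v₁ v₂ w₁ w₂ ; dxw = detᴾ x₁ x₂ w₁ w₂ ; dvx = detᴾ v₁ v₂ x₁ x₂ in
    Qv :* (dvw :* dvw :* Bᴾ x₁ x₂ x₁ x₂) :=
      (Qv :* dxw :+ Bvw :* dvx) :* (Qv :* dxw :+ Bvw :* dvx)
      :+ (Qv :* Bᴾ w₁ w₂ w₁ w₂ :- Bvw :* Bvw) :* (dvx :* dvx))
    refl g₁₁ g₁₂ g₂₂ v₁ v₂ w₁ w₂ x₁ x₂

  proportional-norms : ∀ v w → det v w ≡ 0ℤ →
    proj₁ w * proj₁ w * B v v ≡ proj₁ v * proj₁ v * B w w ×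
    proj₂ w * proj₂ w * B v v ≡ proj₂ v * proj₂ v * B w w
  proportional-norms (v₁ , v₂) (w₁ , w₂) det≡0 =
    vanish _ (first v₁ v₂ w₁ w₂) , vanish _ (second v₁ v₂ w₁ w₂)
    where
    vanish : ∀ {x y} c → x - y ≡ det (v₁ , v₂) (w₁ , w₂) * c → x ≡ y
    vanish {x} {y} c x-y≡det*c = ℤₚ.i-j≡0⇒i≡j x y (trans x-y≡det*c (cong (_* c) det≡0))
    first : ∀ v₁ v₂ w₁ w₂ → w₁ * w₁ * B (v₁ , v₂) (v₁ , v₂) - v₁ * v₁ * B (w₁ , w₂) (w₁ , w₂) ≡
            det (v₁ , v₂) (w₁ , w₂) * (g₂₂ * det (v₁ , v₂) (w₁ , w₂) - + 2 * v₁ * (g₁₂ * w₁ + g₂₂ * w₂))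
    first v₁ v₂ w₁ w₂ = solveᴾ 7 (λ g₁₁ g₁₂ g₂₂ v₁ v₂ w₁ w₂ →
      let Bᴾ = bilinᴾ g₁₁ g₁₂ g₂₂ ; d = detᴾ v₁ v₂ w₁ w₂ in
      w₁ :* w₁ :* Bᴾ v₁ v₂ v₁ v₂ :- v₁ :* v₁ :* Bᴾ w₁ w₂ w₁ w₂ :=
        d :* (g₂₂ :* d :- con (+ 2) :* v₁ :* (g₁₂ :* w₁ :+ g₂₂ :* w₂)))
      refl g₁₁ g₁₂ g₂₂ v₁ v₂ w₁ w₂
    second : ∀ v₁ v₂ w₁ w₂ → w₂ * w₂ * B (v₁ , v₂) (v₁ , v₂) - v₂ * v₂ * B (w₁ , w₂) (w₁ , w₂) ≡
             det (v₁ , v₂) (w₁ , w₂) * (g₁₁ * det (v₁ , v₂) (w₁ , w₂) + + 2 * v₂ * (g₁₁ * w₁ + g₁₂ * w₂))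
    second v₁ v₂ w₁ w₂ = solveᴾ 7 (λ g₁₁ g₁₂ g₂₂ v₁ v₂ w₁ w₂ →
      let Bᴾ = bilinᴾ g₁₁ g₁₂ g₂₂ ; d = detᴾ v₁ v₂ w₁ w₂ in
      w₂ :* w₂ :* Bᴾ v₁ v₂ v₁ v₂ :- v₂ :* v₂ :* Bᴾ w₁ w₂ w₁ w₂ :=
        d :* (g₁₁ :* d :+ con (+ 2) :* v₂ :* (g₁₁ :* w₁ :+ g₁₂ :* w₂)))
      refl g₁₁ g₁₂ g₂₂ v₁ v₂ w₁ w₂

  proportional⇒ratSquare : ∀ {a b} v w → NonZero b → B v v ≡ + a → B w w ≡ + b → det v w ≡ 0ℤ →
                           IsRatSquareQuot a b
  proportional⇒ratSquare v w@(w₁ , w₂) b≢0 Qv≡a Qw≡b det≡0 with w₁ ℤ.≟ 0ℤ | w₂ ℤ.≟ 0ℤ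
  ... | no w₁≢0 | _ = ratSquare (proj₁ v) w₁ w₁≢0
    (subst₂ (λ A B → w₁ * w₁ * A ≡ proj₁ v * proj₁ v * B) Qv≡a Qw≡b (proj₁ (proportional-norms v w det≡0)))
  ... | yes _ | no w₂≢0 = ratSquare (proj₂ v) w₂ w₂≢0
    (subst₂ (λ A B → w₂ * w₂ * A ≡ proj₂ v * proj₂ v * B) Qv≡a Qw≡b (proj₂ (proportional-norms v w det≡0)))
  ... | yes refl | yes refl =
    contradiction (ℤₚ.+-injective (trans (sym Qw≡b) bilin-zero)) (ℕ.≢-nonZero⁻¹ _ {{b≢0}})

0<g*d⇒0<d : ∀ {g d} → 0ℤ ℤ.< g → 0ℤ ℤ.< g * d → 0ℤ ℤ.< d
0<g*d⇒0<d {+0} (ℤ.+<+ ())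
0<g*d⇒0<d {g@(+[1+ _ ])} {d} _ 0<gd = ℤₚ.*-cancelˡ-<-nonNeg g (subst (ℤ._< g * d) (sym (ℤₚ.*-zeroʳ g)) 0<gd)

module _ (L : BinaryLattice) where
  open BinaryLattice L

  0<g₁₁ : 0ℤ ℤ.< g₁₁
  0<g₁₁ = subst (0ℤ ℤ.<_) (bilin-e₁ g₁₁ g₁₂ g₂₂) (posDef (1ℤ , 0ℤ) λ ())

  0<gram : 0ℤ ℤ.< g₁₁ * g₂₂ - g₁₂ * g₁₂
  0<gram = 0<g*d⇒0<d 0<g₁₁ (subst (0ℤ ℤ.<_) (bilin-adjugate g₁₁ g₁₂ g₂₂)
    (posDef (- g₁₂ , g₁₁) (λ eq → ℤₚ.<⇒≢ 0<g₁₁ (sym (cong proj₂ eq)))))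

represents⇒normEquation : ∀ (L : BinaryLattice) {a b c} → NonZero b → ¬ IsRatSquareQuot a b →
  Represents L a → Represents L b → Represents L c →
  ∃ λ D → NonZero D × D ≤ a ℕ.* b × ∃ λ k → k ≢ 0ℤ × ∃ λ X → ∃ λ Z → + a * (k * k * + c) ≡ X * X + + D * Z * Z
represents⇒normEquation L {a} {b} {c} b≢0 a/b≢□ (v , Qv≡a) (w , Qw≡b) (x , Qx≡c) =
  D , D≢0 , D≤ab , k , k≢0 , X , det v x , equation
  where
  open BinaryLattice L
  open ≡-Reasoning
  k = det v w
  t = B v w
  X = Q v * det x w + t * det v x
  gram = g₁₁ * g₂₂ - g₁₂ * g₁₂
  D = ℤ.∣ k ∣ ℕ.* ℤ.∣ k ∣ ℕ.* ℤ.∣ gram ∣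

  k≢0 : k ≢ 0ℤ
  k≢0 = a/b≢□ ∘ proportional⇒ratSquare g₁₁ g₁₂ g₂₂ v w b≢0 Qv≡a Qw≡b

  +D≡Δ : + D ≡ Q v * Q w - t * t
  +D≡Δ = begin
    + (ℤ.∣ k ∣ ℕ.* ℤ.∣ k ∣ ℕ.* ℤ.∣ gram ∣)      ≡⟨ ℤₚ.pos-* (ℤ.∣ k ∣ ℕ.* ℤ.∣ k ∣) _ ⟩
    + (ℤ.∣ k ∣ ℕ.* ℤ.∣ k ∣) * + ℤ.∣ gram ∣     ≡⟨ cong₂ _*_ (trans (ℤₚ.pos-* ℤ.∣ k ∣ ℤ.∣ k ∣) (∣i∣*∣i∣≡i*i k))
                                                            (ℤₚ.0≤i⇒+∣i∣≡i (ℤₚ.<⇒≤ (0<gram L))) ⟩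
    k * k * gram                                ≡⟨ gram-determinant g₁₁ g₁₂ g₂₂ v w ⟨
    Q v * Q w - t * t                           ∎

  instance
    D≢0 : NonZero D
    D≢0 = ℕₚ.m*n≢0 (ℤ.∣ k ∣ ℕ.* ℤ.∣ k ∣) ℤ.∣ gram ∣
      {{ℕₚ.m*n≢0 ℤ.∣ k ∣ ℤ.∣ k ∣ {{ℤ.≢-nonZero k≢0}} {{ℤ.≢-nonZero k≢0}}}} {{ℤ.>-nonZero (0<gram L)}}

  D≤ab : D ≤ a ℕ.* b
  D≤ab = subst (D ≤_) (sym (ℤₚ.+-injective (begin
    + (a ℕ.* b)                          ≡⟨ ℤₚ.pos-* a b ⟩
    + a * + b                            ≡⟨ cong₂ _*_ Qv≡a Qw≡b ⟨
    Q v * Q w                            ≡⟨ identity (Q v * Q w) t ⟩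
    (Q v * Q w - t * t) + t * t          ≡⟨ cong₂ _+_ +D≡Δ (∣i∣*∣i∣≡i*i t) ⟨
    + D + + ℤ.∣ t ∣ * + ℤ.∣ t ∣          ≡⟨ cong (_+_ (+ D)) (ℤₚ.pos-* ℤ.∣ t ∣ ℤ.∣ t ∣) ⟨
    + (D ℕ.+ ℤ.∣ t ∣ ℕ.* ℤ.∣ t ∣)        ∎)))
    (ℕₚ.m≤m+n D (ℤ.∣ t ∣ ℕ.* ℤ.∣ t ∣))
    where
    identity : ∀ q t → q ≡ (q - t * t) + t * t
    identity = solve-∀

  equation : + a * (k * k * + c) ≡ X * X + + D * det v x * det v x
  equation = begin
    + a * (k * k * + c)                           ≡⟨ cong₂ (λ A C → A * (k * k * C)) Qv≡a Qx≡c ⟨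
    Q v * (k * k * Q x)                           ≡⟨ discriminant-identity g₁₁ g₁₂ g₂₂ v w x ⟩
    X * X + (Q v * Q w - t * t) * (det v x * det v x) ≡⟨ cong (λ Δ → X * X + Δ * (det v x * det v x)) +D≡Δ ⟨
    X * X + + D * (det v x * det v x)             ≡⟨ cong (_+_ (X * X)) (ℤₚ.*-assoc (+ D) (det v x) (det v x)) ⟨
    X * X + + D * det v x * det v x               ∎

admissible⇒¬solution : ∀ {B u} → Admissible B u →
  ∀ a M D .{{_ : NonZero a}} .{{_ : NonZero M}} .{{_ : NonZero D}} → D ≤ B → ∀ k → k ≢ 0ℤ →
  ∀ X Z → ¬ (+ a * (k * k * + (a ℕ.* u ℕ.* (M ℕ.* M))) ≡ X * X + + D * Z * Z)
admissible⇒¬solution {B} {u} u-admissible a M D {{a≢0}} {{M≢0}} D≤B k k≢0 X Z eq =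
  ℕ.≢-nonZero⁻¹ _ {{akM≢0}} (cong ℤ.∣_∣ (admissible⇒trivial u-admissible D D≤B {+ a * k * + M} {X} {Z}
    (mkNormEquation (begin
    + u * (+ a * k * + M) * (+ a * k * + M)   ≡⟨ identity (+ u) (+ a) k (+ M) ⟩
    + a * (k * k * (+ a * + u * (+ M * + M))) ≡⟨ cong (λ C → + a * (k * k * C)) +c ⟨
    + a * (k * k * + (a ℕ.* u ℕ.* (M ℕ.* M))) ≡⟨ eq ⟩
    X * X + + D * Z * Z                       ∎))))
  where
  open ≡-Reasoning
  akM≢0 : ℤ.NonZero (+ a * k * + M)
  akM≢0 = ℤₚ.i*j≢0 (+ a * k) (+ M) {{ℤₚ.i*j≢0 (+ a) k {{a≢0}} {{ℤ.≢-nonZero k≢0}}}} {{M≢0}}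
  +c : + (a ℕ.* u ℕ.* (M ℕ.* M)) ≡ + a * + u * (+ M * + M)
  +c = trans (ℤₚ.pos-* (a ℕ.* u) (M ℕ.* M)) (cong₂ _*_ (ℤₚ.pos-* a u) (ℤₚ.pos-* M M))
  identity : ∀ u a k M → u * (a * k * M) * (a * k * M) ≡ a * (k * k * (a * u * (M * M)))
  identity = solve-∀

proposition2p2 : (a b : ℕ) → NonZero a → NonZero b → ¬ IsRatSquareQuot a b →
    ∀ (N : ℕ) → ∃ λ (c : ℕ) → N < c × NonZero c ×
      ((L : BinaryLattice) → ¬ (Represents L a × Represents L b × Represents L c))
proposition2p2 a b a≢0 b≢0 a/b≢□ N = c , N<c , c≢0 , no-lattice
  where
  u = proj₁ (∃-admissible (a ℕ.* b))
  u-admissible = proj₂ (∃-admissible (a ℕ.* b))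
  M = suc N
  c = a ℕ.* u ℕ.* (M ℕ.* M)
  instance
    au≢0 = ℕₚ.m*n≢0 a u {{a≢0}} {{admissible⇒nonZero u-admissible}}
    c≢0 : NonZero c
    c≢0 = ℕₚ.m*n≢0 (a ℕ.* u) (M ℕ.* M)
  N<c : N < c
  N<c = ℕₚ.<-≤-trans (ℕₚ.n<1+n N) (ℕₚ.≤-trans (ℕₚ.m≤m*n M M) (ℕₚ.m≤n*m (M ℕ.* M) (a ℕ.* u)))
  no-lattice : (L : BinaryLattice) → ¬ (Represents L a × Represents L b × Represents L c)
  no-lattice L (La , Lb , Lc) =
    let D , D≢0 , D≤ab , k , k≢0 , X , Z , eq = represents⇒normEquation L b≢0 a/b≢□ La Lb Lc
    in admissible⇒¬solution u-admissible a M D {{a≢0}} {{_}} {{D≢0}} D≤ab k k≢0 X Z eq
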